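{- Let $n \in \mathbf{N}$ and let $k$ be an integer with $n/2 < k \le n$, and put $e = k-(n-k)$. In the two-player game described in the context, the value of the starting position (the multiset consisting of $n$ copies of $1$) is at most $B(n-k) + k - (n-k)$.
   Context: Fix $n$, $k$ and $e = k-(n-k)$. A position is a finite multiset of non-negative integers. The game starts at the multiset $\{1,\ldots,1\}$ with $n$ elements. On each turn, the Selector chooses two distinct elements (i.e. two different entries of the multiset) $w \ge w'$, and the Assigner replaces them by a single element equal to either $w+w'$ or $w-w'$ (of the Assigner's choosing). (The sum of the elements always has the same parity as $e$.) A position $\{w_1,\ldots,w_c\}$ with $w_1 \ge \cdots \ge w_c$ is final if $w_1 \ge s+1$, where $s$ is defined by $2s+e = w_1+\cdots+w_c$; the game ends as soon as a final position is reached. The Selector aims to maximize, and the Assigner to minimize, the number of elements of the final position reached. The value $V(M)$ of a position $M$ is the number of elements of the final position reached from $M$ under optimal play by both players. For $m \in \mathbf{N}_0$, $B(m)$ is the number of digits $1$ in the binary expansion of $m$. -}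

module Defs where

open import Data.Nat using (ℕ; zero; suc; _+_; _*_; _∸_; _≤_; _≤?_; _⊔_; _⊓_)
open import Data.Nat.DivMod using (_%_; _/_)
open import Data.List using (List; []; _∷_; length; map; _++_; foldr)
open import Data.Nat.ListAction using (sum)
open import Data.Product using (_×_; _,_)
open import Relation.Nullary using (yes; no)

-- A position (finite multiset of naturals) is represented by a list;
-- all notions below are invariant under permutation of the list.
Position : Set
Position = List ℕ

-- largest element (w₁); 0 for the empty list (never reached in the game)
maxList : List ℕ → ℕ
maxList = foldr _⊔_ 0

-- A position M is final iff w₁ ≥ s + 1 where 2s + e = ΣM,
-- i.e. (multiplying by 2) iff ΣM + 2 ≤ 2·w₁ + e.
Final : ℕ → Position → Set
Final e M = sum M + 2 ≤ 2 * maxList M + e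

-- All ways for the Selector to choose two distinct entries (by position)
-- of the list: returns (a , b , rest) with rest the remaining entries.
picks1 : ℕ → List ℕ → List (ℕ × ℕ × List ℕ)
picks1 a [] = []
picks1 a (b ∷ xs) = (a , b , xs) ∷ map (λ { (p , q , r) → (p , q , b ∷ r) }) (picks1 a xs)

picks : List ℕ → List (ℕ × ℕ × List ℕ)
picks [] = []
picks (x ∷ xs) = picks1 x xs ++ map (λ { (p , q , r) → (p , q , x ∷ r) }) (picks xs)

maximum : List ℕ → ℕ
maximum = foldr _⊔_ 0

-- Minimax value with fuel; each move reduces the number of elements by 1,
-- so fuel = length M suffices.  Selector maximises over picks, Assigner
-- minimises over the two replacements w + w' and w - w' (w ≥ w').
valueF : ℕ → ℕ → Position → ℕ
valueF e zero M = length M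
valueF e (suc f) M with sum M + 2 ≤? 2 * maxList M + e
... | yes _ = length M
... | no _ with picks M
...   | [] = length M
...   | p ∷ ps = maximum (map step (p ∷ ps))
  where
  step : ℕ × ℕ × List ℕ → ℕ
  step (a , b , r) =
    valueF e f (((a ⊔ b) + (a ⊓ b)) ∷ r) ⊓ valueF e f (((a ⊔ b) ∸ (a ⊓ b)) ∷ r)

V : ℕ → Position → ℕ
V e M = valueF e (length M) M

-- B(m): number of binary digits 1 of m (fuel m ≥ number of bits)
B′ : ℕ → ℕ → ℕ
B′ zero m = 0
B′ (suc f) m = m % 2 + B′ f (m / 2)

B : ℕ → ℕ
B m = B′ m m

module Submission where

-- Let c(M) be the coefficient of x^s in (1 + x)^(-e) ∏_{w ∈ M} (1 + x^w), where ΣM = 2s + e.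
-- Since (1 + x^a)(1 + x^b) = (1 + x^(a+b)) + x^a (1 + x^(b-a)), the c of a position is the sum of
-- the c's of the two positions the Assigner may create, so once 2^(β+1) ∤ c she can keep it so.
-- Coefficients of x^t with t + e > ΣM are divisible by 2^(|M| + 1 − e): by a telescoping argument
-- each factor 1 + x^w contributes a 2 and each factor (1 + x)^(-1) removes one.  A final position
-- has an element w > s, and dropping it shows 2^(|M| − e) ∣ c; so the game ends with at most β + e
-- elements.  Initially c = C(2m, m) with m = n − k, whose 2-adic valuation is B(m) by
-- (m + 1) C(2m + 2, m + 1) = 2 (2m + 1) C(2m, m) and the carry rule B(m) + 1 = B(m + 1) + v₂(m + 1).

open import Data.List using ([]; _∷_; length; replicate)
open import Data.List.Properties using (foldr-preservesᵇ)
open import Data.List.Relation.Binary.Permutation.Propositional as ↭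
  using (_↭_; refl; prep; swap; ↭-trans)
open import Data.List.Relation.Binary.Permutation.Propositional.Properties using (↭-length; shifts)
open import Data.List.Relation.Unary.All as All using (All; []; _∷_)
open import Data.List.Relation.Unary.All.Properties using (map⁺; ++⁺)
open import Data.Nat.ListAction using (sum)
open import Data.Nat.ListAction.Properties using (sum-↭)
open import Data.Nat.Tactic.RingSolver using () renaming (solve-∀ to ℕ-solve-∀)
open import Data.Product using (_×_; _,_; proj₁; ∃-syntax)
open import Data.Sum using (_⊎_; inj₁; inj₂; [_,_]′)
open import Function using (_∘_; _$_)
open import Relation.Binary.PropositionalEquality
  using (_≡_; _≢_; refl; sym; trans; cong; cong₂; subst; subst₂; module ≡-Reasoning)
open import Relation.Nullary using (¬_; yes; no; contradiction)

open import Defs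

module Coefficients where

  open import Data.Integer as ℤ using (ℤ; +_; -[1+_]; 0ℤ; 1ℤ; _+_; _-_; -_; _*_)
  import Data.Integer.Properties as ℤ
  open import Algebra.Properties.CommutativeSemigroup ℤ.+-commutativeSemigroup using (interchange)
  open import Data.Integer.Divisibility.Signed using (_∣_; divides; ∣m∣n⇒∣m+n; ∣m∣n⇒∣m-n)
  open import Data.Integer.Tactic.RingSolver using (solve-∀)
  open import Data.Nat as ℕ using (ℕ; zero; suc; _∸_; _^_; _≤_; _<_; z≤n; s≤s)
  import Data.Nat.Properties as ℕ
  open import Data.Nat.Combinatorics using (_C_; nCk+nC[k+1]≡[n+1]C[k+1])

  negBinom : ℕ → ℤ → ℤ
  negBinom e       -[1+ _ ]   = 0ℤ
  negBinom e       (+ zero)   = 1ℤ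
  negBinom zero    (+ suc k)  = 0ℤ
  negBinom (suc e) (+ suc k)  = negBinom e (+ suc k) - negBinom (suc e) (+ k)

  -- coeff e M t is the coefficient of x^t in (1 + x)^(-e) · ∏_{w ∈ M} (1 + x^w).
  coeff : ℕ → Position → ℤ → ℤ
  coeff e []      t = negBinom e t
  coeff e (w ∷ M) t = coeff e M t + coeff e M (t - + w)

  negBinom-pascal : ∀ e t → negBinom (suc e) t + negBinom (suc e) (t - 1ℤ) ≡ negBinom e t
  negBinom-pascal e -[1+ k ]  = refl
  negBinom-pascal e (+ zero)  = refl
  negBinom-pascal e (+ suc k) = cancel (negBinom e (+ suc k)) (negBinom (suc e) (+ k))
    where cancel : ∀ a b → (a - b) + b ≡ a
          cancel = solve-∀

  coeff-pascal : ∀ e M t → coeff (suc e) M t + coeff (suc e) M (t - 1ℤ) ≡ coeff e M t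
  coeff-pascal e []      t = negBinom-pascal e t
  coeff-pascal e (w ∷ M) t = begin
    (A t + A (t - + w)) + (A (t - 1ℤ) + A (t - 1ℤ - + w))
      ≡⟨ cong (λ u → (A t + A (t - + w)) + (A (t - 1ℤ) + A u)) (shuffle t (+ w)) ⟩
    (A t + A (t - + w)) + (A (t - 1ℤ) + A (t - + w - 1ℤ))
      ≡⟨ interchange (A t) (A (t - + w)) (A (t - 1ℤ)) (A (t - + w - 1ℤ)) ⟩
    (A t + A (t - 1ℤ)) + (A (t - + w) + A (t - + w - 1ℤ))
      ≡⟨ cong₂ _+_ (coeff-pascal e M t) (coeff-pascal e M (t - + w)) ⟩
    coeff e M t + coeff e M (t - + w) ∎
    where
    open ≡-Reasoning
    A = coeff (suc e) M
    shuffle : ∀ a b → a - 1ℤ - b ≡ a - b - 1ℤ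
    shuffle = solve-∀

  coeff-negative : ∀ e M k → coeff e M -[1+ k ] ≡ 0ℤ
  coeff-negative e []          k = refl
  coeff-negative e (zero ∷ M)  k = cong₂ _+_ (coeff-negative e M k) (coeff-negative e M k)
  coeff-negative e (suc w ∷ M) k = cong₂ _+_ (coeff-negative e M k) (coeff-negative e M (suc (k ℕ.+ w)))

  m-[1+m+n]≡-[1+n] : ∀ m n → + m - + (suc m ℕ.+ n) ≡ -[1+ n ]
  m-[1+m+n]≡-[1+n] m n = trans (cong (λ z → + m - z) (ℤ.pos-+ (suc m) n)) (lemma (+ m) (+ n))
    where lemma : ∀ m n → m - ((1ℤ + m) + n) ≡ - (1ℤ + n)
          lemma = solve-∀

  coeff-below : ∀ e M {s w} → s < w → coeff e M (+ s - + w) ≡ 0ℤ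
  coeff-below e M {s} s<w with r , refl ← ℕ.m≤n⇒∃[o]m+o≡n s<w =
    trans (cong (coeff e M) (m-[1+m+n]≡-[1+n] s r)) (coeff-negative e M r)

  coeff-∷ : ∀ e w {M N} → (∀ t → coeff e M t ≡ coeff e N t) → ∀ t → coeff e (w ∷ M) t ≡ coeff e (w ∷ N) t
  coeff-∷ e w M≈N t = cong₂ _+_ (M≈N t) (M≈N (t - + w))

  coeff-swap : ∀ e a b M t → coeff e (a ∷ b ∷ M) t ≡ coeff e (b ∷ a ∷ M) t
  coeff-swap e a b M t = begin
    (C t + C (t - + b)) + (C (t - + a) + C (t - + a - + b))
      ≡⟨ cong (λ u → (C t + C (t - + b)) + (C (t - + a) + C u)) (commute t (+ a) (+ b)) ⟩
    (C t + C (t - + b)) + (C (t - + a) + C (t - + b - + a))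
      ≡⟨ interchange (C t) (C (t - + b)) (C (t - + a)) (C (t - + b - + a)) ⟩
    (C t + C (t - + a)) + (C (t - + b) + C (t - + b - + a)) ∎
    where
    open ≡-Reasoning
    C = coeff e M
    commute : ∀ t a b → t - a - b ≡ t - b - a
    commute = solve-∀

  coeff-↭ : ∀ e {M N} → M ↭ N → ∀ t → coeff e M t ≡ coeff e N t
  coeff-↭ e refl                      t = refl
  coeff-↭ e (prep {xs = M} {N} w p)   t = coeff-∷ e w {M} {N} (coeff-↭ e p) t
  coeff-↭ e (swap {xs = M} {N} a b p) t =
    trans (coeff-∷ e a {b ∷ M} {b ∷ N} (coeff-∷ e b {M} {N} (coeff-↭ e p)) t) (coeff-swap e a b N t)
  coeff-↭ e (↭.trans p q)             t = trans (coeff-↭ e p t) (coeff-↭ e q t)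

  pos-∸ : ∀ {m n} → n ≤ m → + (m ∸ n) ≡ + m - + n
  pos-∸ {m} {n} n≤m = sym (trans (ℤ.m-n≡m⊖n m n) (ℤ.⊖-≥ n≤m))

  coeff-merge : ∀ e {x y} r t → x ≤ y →
    coeff e (x ∷ y ∷ r) t ≡ coeff e (y ℕ.+ x ∷ r) t + coeff e (y ∸ x ∷ r) (t - + x)
  coeff-merge e {x} {y} r t x≤y = begin
    (C t + C (t - + y)) + (C (t - + x) + C (t - + x - + y))
      ≡⟨ rearrange (C t) (C (t - + y)) (C (t - + x)) (C (t - + x - + y)) ⟩
    (C t + C (t - + x - + y)) + (C (t - + x) + C (t - + y))
      ≡⟨ cong₂ (λ u v → (C t + C u) + (C (t - + x) + C v)) sum-shift diff-shift ⟩
    (C t + C (t - + (y ℕ.+ x))) + (C (t - + x) + C (t - + x - + (y ∸ x))) ∎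
    where
    open ≡-Reasoning
    C = coeff e r
    rearrange : ∀ a b c d → (a + b) + (c + d) ≡ (a + d) + (c + b)
    rearrange = solve-∀
    sum-shift : t - + x - + y ≡ t - + (y ℕ.+ x)
    sum-shift = trans (lemma t (+ x) (+ y)) (cong (λ z → t - z) (sym (ℤ.pos-+ y x)))
      where lemma : ∀ t x y → t - x - y ≡ t - (y + x)
            lemma = solve-∀
    diff-shift : t - + y ≡ t - + x - + (y ∸ x)
    diff-shift = trans (lemma t (+ x) (+ y)) (cong (λ z → t - + x - z) (sym (pos-∸ x≤y)))
      where lemma : ∀ t x y → t - y ≡ t - x - (y - x)
            lemma = solve-∀

  coeff-merge-within : ∀ e {x y s} r → x ≤ y → x ≤ s →
    coeff e (x ∷ y ∷ r) (+ s) ≡ coeff e (y ℕ.+ x ∷ r) (+ s) + coeff e (y ∸ x ∷ r) (+ (s ∸ x))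
  coeff-merge-within e {x} {y} {s} r x≤y x≤s =
    trans (coeff-merge e r (+ s) x≤y) (cong (λ t → coeff e (y ℕ.+ x ∷ r) (+ s) + coeff e (y ∸ x ∷ r) t) (sym (pos-∸ x≤s)))

  coeff-merge-beyond : ∀ e {x y s} r → x ≤ y → s < x → coeff e (x ∷ y ∷ r) (+ s) ≡ coeff e (y ℕ.+ x ∷ r) (+ s)
  coeff-merge-beyond e {x} {y} r x≤y s<x =
    trans (coeff-merge e r _ x≤y)
      (trans (cong (λ z → coeff e (y ℕ.+ x ∷ r) _ + z) (coeff-below e (y ∸ x ∷ r) s<x)) (ℤ.+-identityʳ _))

  infix 4 2^_∣_
  2^_∣_ : ℕ → ℤ → Set
  2^ k ∣ x = + (2 ^ k) ∣ x

  2^0∣ : ∀ x → 2^ 0 ∣ x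
  2^0∣ x = divides x (sym (ℤ.*-identityʳ x))

  2^∣-double : ∀ k {x} → 2^ k ∣ x → 2^ suc k ∣ x + x
  2^∣-double k (divides q refl) = divides q (trans (lemma q (+ (2 ^ k))) (cong (q *_) (sym (ℤ.pos-* 2 (2 ^ k)))))
    where lemma : ∀ q p → q * p + q * p ≡ q * (+ 2 * p)
          lemma = solve-∀

  telescope-∣ : ∀ {d} (A : ℤ → ℤ) t w → d ∣ A t + A t →
    (∀ i → i < w → d ∣ A (t - + i) + A (t - + suc i)) → d ∣ A t + A (t - + w)
  telescope-∣ {d} A t w d∣2At d∣steps = proj₁ (sum-and-difference w d∣steps)
    where
    A[t-0]≡At : A (t - + 0) ≡ A t
    A[t-0]≡At = cong A (ℤ.+-identityʳ t)

    sum-and-difference : ∀ w → (∀ i → i < w → d ∣ A (t - + i) + A (t - + suc i)) →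
      d ∣ A t + A (t - + w) × d ∣ A t - A (t - + w)
    sum-and-difference zero _ =
        subst (λ z → d ∣ A t + z) (sym A[t-0]≡At) d∣2At
      , subst (λ z → d ∣ A t - z) (sym A[t-0]≡At) (subst (d ∣_) (sym (ℤ.+-inverseʳ (A t))) (divides 0ℤ refl))
    sum-and-difference (suc w) d∣steps
      with d∣sum , d∣diff ← sum-and-difference w (λ i i<w → d∣steps i (ℕ.m<n⇒m<1+n i<w)) =
        subst (d ∣_) (undo-diff (A t) (A (t - + w)) (A (t - + suc w))) (∣m∣n⇒∣m+n d∣diff d∣step)
      , subst (d ∣_) (undo-sum (A t) (A (t - + w)) (A (t - + suc w))) (∣m∣n⇒∣m-n d∣sum d∣step)
      where
      d∣step = d∣steps w ℕ.≤-refl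
      undo-diff : ∀ a b c → a - b + (b + c) ≡ a + c
      undo-diff = solve-∀
      undo-sum : ∀ a b c → a + b - (b + c) ≡ a - c
      undo-sum = solve-∀

  -- The degree condition ΣM < u is stated as u ≡ ΣM + 1 + d with an explicit slack d.
  drop-summand : ∀ {u} w S d → u ≡ + (w ℕ.+ S) + 1ℤ + + d → u - + w ≡ + S + 1ℤ + + d
  drop-summand {u} w S d u≡ = begin
    u - + w                        ≡⟨ cong (_- + w) u≡ ⟩
    + (w ℕ.+ S) + 1ℤ + + d - + w   ≡⟨ cong (λ z → z + 1ℤ + + d - + w) (ℤ.pos-+ w S) ⟩
    + w + + S + 1ℤ + + d - + w     ≡⟨ cancel (+ w) (+ S) (+ d) ⟩
    + S + 1ℤ + + d                 ∎
    where
    open ≡-Reasoning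
    cancel : ∀ w S d → w + S + 1ℤ + d - w ≡ S + 1ℤ + d
    cancel = solve-∀

  absorb-summand : ∀ {u} w S d → u ≡ + (w ℕ.+ S) + 1ℤ + + d → u ≡ + S + 1ℤ + + (w ℕ.+ d)
  absorb-summand {u} w S d u≡ = begin
    u                              ≡⟨ u≡ ⟩
    + (w ℕ.+ S) + 1ℤ + + d         ≡⟨ cong (λ z → z + 1ℤ + + d) (ℤ.pos-+ w S) ⟩
    + w + + S + 1ℤ + + d           ≡⟨ move (+ w) (+ S) (+ d) ⟩
    + S + 1ℤ + (+ w + + d)         ≡⟨ cong (λ z → + S + 1ℤ + z) (ℤ.pos-+ w d) ⟨
    + S + 1ℤ + + (w ℕ.+ d)         ∎
    where
    open ≡-Reasoning
    move : ∀ w S d → w + S + 1ℤ + d ≡ S + 1ℤ + (w + d)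
    move = solve-∀

  coeff₀-vanishes : ∀ M t d → t ≡ + sum M + 1ℤ + + d → coeff 0 M t ≡ 0ℤ
  coeff₀-vanishes []      _ d refl = refl
  coeff₀-vanishes (w ∷ M) t d t≡ = cong₂ _+_
    (coeff₀-vanishes M t (w ℕ.+ d) (absorb-summand w (sum M) d t≡))
    (coeff₀-vanishes M (t - + w) d (drop-summand w (sum M) d t≡))

  -- With A = coeff (suc e) M, A u + A (u − 1) = coeff e M u by coeff-pascal, so A t + A (t − w)
  -- telescopes to 2 A t plus a signed sum of w coefficients for e.
  coeff-divisible : ∀ M e t d k → k ℕ.+ e ≤ suc (length M) →
    t + + e ≡ + sum M + 1ℤ + + d → 2^ k ∣ coeff e M t
  coeff-divisible M e       t d zero    _ _ = 2^0∣ _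
  coeff-divisible M zero    t d (suc k) _ t≡ =
    subst (2^ suc k ∣_) (sym (coeff₀-vanishes M t d (trans (sym (ℤ.+-identityʳ t)) t≡))) (divides 0ℤ refl)
  coeff-divisible [] (suc e) t d (suc k) k+e≤1 _ =
    contradiction (ℕ.≤-trans (ℕ.+-mono-≤ (s≤s z≤n) (s≤s z≤n)) k+e≤1) λ { (s≤s ()) }
  coeff-divisible (w ∷ M) (suc e) t d (suc k) (s≤s k+e≤) t≡ =
    telescope-∣ A t w (2^∣-double k 2^k∣At) steps
    where
    A = coeff (suc e) M
    2^k∣At : 2^ k ∣ A t
    2^k∣At = coeff-divisible M (suc e) t (w ℕ.+ d) k k+e≤ (absorb-summand w (sum M) d t≡)
    steps : ∀ i → i < w → 2^ suc k ∣ A (t - + i) + A (t - + suc i)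
    steps i i<w with r , refl ← ℕ.m≤n⇒∃[o]m+o≡n i<w =
      subst (2^ suc k ∣_) (sym pascal)
        (coeff-divisible M e (t - + i) (r ℕ.+ d) (suc k) (subst (_≤ suc (length M)) (ℕ.+-suc k e) k+e≤) shifted)
      where
      pascal : A (t - + i) + A (t - + suc i) ≡ coeff e M (t - + i)
      pascal = trans (cong (λ z → A (t - + i) + A z) (step-back t (+ i))) (coeff-pascal e M (t - + i))
        where step-back : ∀ t i → t - (1ℤ + i) ≡ t - i - 1ℤ
              step-back = solve-∀
      shifted : t - + i + + e ≡ + sum M + 1ℤ + + (r ℕ.+ d)
      shifted = begin
        t - + i + + e               ≡⟨ regroup t (+ i) (+ e) ⟩
        t + + suc e - + suc i       ≡⟨ drop-summand (suc i) (r ℕ.+ sum M) d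
                                         (trans t≡ (cong (λ z → + z + 1ℤ + + d) (ℕ.+-assoc (suc i) r (sum M)))) ⟩
        + (r ℕ.+ sum M) + 1ℤ + + d  ≡⟨ absorb-summand r (sum M) d refl ⟩
        + sum M + 1ℤ + + (r ℕ.+ d)  ∎
        where
        open ≡-Reasoning
        regroup : ∀ t i e → t - i + e ≡ t + (1ℤ + e) - (1ℤ + i)
        regroup = solve-∀

  extract-large : ∀ {a} M → suc a ≤ maxList M → ∃[ w ] ∃[ M′ ] (suc a ≤ w × M ↭ w ∷ M′)
  extract-large (x ∷ M) a<max with ℕ.⊔-sel x (maxList M)
  ... | inj₁ ⊔≡x = x , M , subst (suc _ ≤_) ⊔≡x a<max , refl
  ... | inj₂ ⊔≡max with w , M′ , a<w , M↭ ← extract-large M (subst (suc _ ≤_) ⊔≡max a<max) =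
    w , x ∷ M′ , a<w , ↭-trans (prep x M↭) (swap x w refl)

  final⇒half<max : ∀ {e s} M → Final e M → sum M ≡ 2 ℕ.* s ℕ.+ e → suc s ≤ maxList M
  final⇒half<max {e} {s} M final sum≡ =
    ℕ.*-cancelˡ-≤ 2 (ℕ.+-cancelʳ-≤ e _ _ (subst (_≤ 2 ℕ.* maxList M ℕ.+ e) sum+2≡ final))
    where
    sum+2≡ : sum M ℕ.+ 2 ≡ 2 ℕ.* suc s ℕ.+ e
    sum+2≡ = trans (cong (ℕ._+ 2) sum≡) (lemma s e)
      where lemma : ∀ s e → 2 ℕ.* s ℕ.+ e ℕ.+ 2 ≡ 2 ℕ.* suc s ℕ.+ e
            lemma = ℕ-solve-∀

  final-divisible : ∀ {e s} M k → Final e M → sum M ≡ 2 ℕ.* s ℕ.+ e →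
    k ℕ.+ e ≤ length M → 2^ k ∣ coeff e M (+ s)
  final-divisible {e} {s} M k final sum≡ k+e≤
    with w , M′ , s<w , M↭ ← extract-large M (final⇒half<max M final sum≡)
    with r , refl ← ℕ.m≤n⇒∃[o]m+o≡n s<w =
    subst (2^ k ∣_) (sym coeff≡)
      (coeff-divisible M′ e (+ s) r k (subst (k ℕ.+ e ≤_) (↭-length M↭) k+e≤) half+e≡)
    where
    half+e≡ℕ : s ℕ.+ e ≡ sum M′ ℕ.+ 1 ℕ.+ r
    half+e≡ℕ = ℕ.+-cancelˡ-≡ s _ _ (begin
      s ℕ.+ (s ℕ.+ e)             ≡⟨ double s e ⟩
      2 ℕ.* s ℕ.+ e               ≡⟨ sum≡ ⟨
      sum M                       ≡⟨ sum-↭ M↭ ⟩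
      suc s ℕ.+ r ℕ.+ sum M′      ≡⟨ regroup s r (sum M′) ⟩
      s ℕ.+ (sum M′ ℕ.+ 1 ℕ.+ r)  ∎)
      where
      open ≡-Reasoning
      double : ∀ s e → s ℕ.+ (s ℕ.+ e) ≡ 2 ℕ.* s ℕ.+ e
      double = ℕ-solve-∀
      regroup : ∀ s r S → suc s ℕ.+ r ℕ.+ S ≡ s ℕ.+ (S ℕ.+ 1 ℕ.+ r)
      regroup = ℕ-solve-∀
    half+e≡ : + s + + e ≡ + sum M′ + 1ℤ + + r
    half+e≡ = begin
      + s + + e               ≡⟨ ℤ.pos-+ s e ⟨
      + (s ℕ.+ e)             ≡⟨ cong +_ half+e≡ℕ ⟩
      + (sum M′ ℕ.+ 1 ℕ.+ r)  ≡⟨ ℤ.pos-+ (sum M′ ℕ.+ 1) r ⟩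
      + (sum M′ ℕ.+ 1) + + r  ≡⟨ cong (_+ + r) (ℤ.pos-+ (sum M′) 1) ⟩
      + sum M′ + 1ℤ + + r     ∎
      where open ≡-Reasoning
    coeff≡ : coeff e M (+ s) ≡ coeff e M′ (+ s)
    coeff≡ = begin
      coeff e M (+ s)                                         ≡⟨ coeff-↭ e M↭ (+ s) ⟩
      coeff e M′ (+ s) + coeff e M′ (+ s - + (suc s ℕ.+ r))  ≡⟨ cong (λ z → coeff e M′ (+ s) + z) (coeff-below e M′ s<w) ⟩
      coeff e M′ (+ s) + 0ℤ                                   ≡⟨ ℤ.+-identityʳ _ ⟩
      coeff e M′ (+ s)                                        ∎
      where open ≡-Reasoning

  coeff-replicate : ∀ e N t → coeff e (replicate (e ℕ.+ N) 1) t ≡ coeff 0 (replicate N 1) t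
  coeff-replicate zero    N t = refl
  coeff-replicate (suc e) N t = trans (coeff-pascal e (replicate (e ℕ.+ N) 1) t) (coeff-replicate e N t)

  coeff₀-replicate : ∀ N k → coeff 0 (replicate N 1) (+ k) ≡ + (N C k)
  coeff₀-replicate zero    zero    = refl
  coeff₀-replicate zero    (suc k) = refl
  coeff₀-replicate (suc N) zero    = cong₂ _+_ (coeff₀-replicate N 0) (coeff-negative 0 (replicate N 1) 0)
  coeff₀-replicate (suc N) (suc k) = begin
    coeff 0 (replicate N 1) (+ suc k) + coeff 0 (replicate N 1) (+ k)
      ≡⟨ cong₂ _+_ (coeff₀-replicate N (suc k)) (coeff₀-replicate N k) ⟩
    + (N C suc k) + + (N C k)   ≡⟨ ℤ.pos-+ (N C suc k) (N C k) ⟨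
    + (N C suc k ℕ.+ N C k)     ≡⟨ cong +_ (ℕ.+-comm (N C suc k) (N C k)) ⟩
    + (N C k ℕ.+ N C suc k)     ≡⟨ cong +_ (nCk+nC[k+1]≡[n+1]C[k+1] N k) ⟩
    + (suc N C suc k)           ∎
    where open ≡-Reasoning

open Coefficients

open import Data.Integer using (+_)
import Data.Integer.Divisibility.Signed as ℤ
open import Data.Nat using (ℕ; zero; suc; _+_; _*_; _∸_; _^_; _⊔_; _⊓_; _≤_; _<_; _≤?_; z≤n; s≤s)
open import Data.Nat.Combinatorics using (_C_; nCk+nC[k+1]≡[n+1]C[k+1]; nCk≡nC[n∸k]; nC1≡n)
open import Data.Nat.DivMod using (_%_; _/_; [m+kn]%n≡m%n; m*n%n≡0; m*n/n≡m; +-distrib-/; m/n<m)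
open import Data.Nat.Divisibility using (_∣_; _∤_; divides; ∣n⇒∣m*n; *-cancelˡ-∣; n∣m⇒m%n≡0)
open import Data.Nat.Induction using (<-rec)
open import Data.Nat.Primality using (euclidsLemma; prime?)
open import Data.Nat.Properties
open import Relation.Nullary.Decidable using (from-yes)

record Indivisible (e β : ℕ) (M : Position) : Set where
  constructor indivisible
  field
    half   : ℕ
    sum≡   : sum M ≡ 2 * half + e
    ∤coeff : ¬ 2^ suc β ∣ coeff e M (+ half)

Indivisible-↭ : ∀ {e β M N} → M ↭ N → Indivisible e β M → Indivisible e β N
Indivisible-↭ {e} {β} M↭N (indivisible s sum≡ ∤coeff) =
  indivisible s (trans (sym (sum-↭ M↭N)) sum≡) (∤coeff ∘ subst (2^ suc β ∣_) (sym (coeff-↭ e M↭N (+ s))))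

Indivisible-final : ∀ {e β M} → Final e M → Indivisible e β M → length M ≤ β + e
Indivisible-final {β = β} {M} final (indivisible s sum≡ ∤coeff) =
  ≮⇒≥ λ β+e<len → ∤coeff (final-divisible M (suc β) final sum≡ β+e<len)

merge-sum : ∀ {x y s e} R → x ≤ y → x ≤ s → x + (y + R) ≡ 2 * s + e → y ∸ x + R ≡ 2 * (s ∸ x) + e
merge-sum {x} {e = e} R x≤y x≤s sum≡
  with y′ , refl ← m≤n⇒∃[o]m+o≡n x≤y | s′ , refl ← m≤n⇒∃[o]m+o≡n x≤s
  rewrite m+n∸m≡n x y′ | m+n∸m≡n x s′ = +-cancelˡ-≡ (x + x) _ _ (begin
    x + x + (y′ + R)        ≡⟨ regroup x y′ R ⟩
    x + (x + y′ + R)        ≡⟨ sum≡ ⟩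
    2 * (x + s′) + e        ≡⟨ expand x s′ e ⟩
    x + x + (2 * s′ + e)    ∎)
  where
  open ≡-Reasoning
  regroup : ∀ x y R → x + x + (y + R) ≡ x + (x + y + R)
  regroup = ℕ-solve-∀
  expand : ∀ x s e → 2 * (x + s) + e ≡ x + x + (2 * s + e)
  expand = ℕ-solve-∀

Indivisible-merge : ∀ {e β x y} r → x ≤ y → Indivisible e β (x ∷ y ∷ r) →
  Indivisible e β (y + x ∷ r) ⊎ Indivisible e β (y ∸ x ∷ r)
Indivisible-merge {e} {β} {x} {y} r x≤y (indivisible s sum≡ ∤coeff)
  with + (2 ^ suc β) ℤ.∣? coeff e (y + x ∷ r) (+ s)
... | no ∤sum = inj₁ (indivisible s (trans (swap-sum x y (sum r)) sum≡) ∤sum)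
  where swap-sum : ∀ x y R → y + x + R ≡ x + (y + R)
        swap-sum = ℕ-solve-∀
... | yes ∣sum with x ≤? s
...   | yes x≤s = inj₂ (indivisible (s ∸ x) (merge-sum (sum r) x≤y x≤s sum≡)
                  (∤coeff ∘ subst (2^ suc β ∣_) (sym (coeff-merge-within e r x≤y x≤s)) ∘ ℤ.∣m∣n⇒∣m+n ∣sum))
...   | no x≰s  = contradiction (subst (2^ suc β ∣_) (sym (coeff-merge-beyond e r x≤y (≰⇒> x≰s))) ∣sum) ∤coeff

PickOf : Position → ℕ × ℕ × Position → Set
PickOf M (a , b , r) = M ↭ a ∷ b ∷ r

picks1-↭ : ∀ a M → All (PickOf (a ∷ M)) (picks1 a M)
picks1-↭ a []      = []
picks1-↭ a (b ∷ M) = refl ∷ map⁺ (All.map (λ { {p , q , r} a∷M↭ →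
  ↭-trans (swap a b refl) (↭-trans (prep b a∷M↭) (shifts (b ∷ []) (p ∷ q ∷ []))) }) (picks1-↭ a M))

picks-↭ : ∀ M → All (PickOf M) (picks M)
picks-↭ []      = []
picks-↭ (x ∷ M) = ++⁺ (picks1-↭ x M) (map⁺ (All.map (λ { {p , q , r} M↭ →
  ↭-trans (prep x M↭) (shifts (x ∷ []) (p ∷ q ∷ [])) }) (picks-↭ M)))

picks≡[]⇒length≤1 : ∀ M → picks M ≡ [] → length M ≤ 1
picks≡[]⇒length≤1 []          _ = z≤n
picks≡[]⇒length≤1 (x ∷ [])    _ = s≤s z≤n
picks≡[]⇒length≤1 (x ∷ y ∷ M) ()

↭-⊓⊔ : ∀ a b r → a ∷ b ∷ r ↭ a ⊓ b ∷ a ⊔ b ∷ r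
↭-⊓⊔ a b r with ≤-total a b
... | inj₁ a≤b = subst₂ (λ u v → a ∷ b ∷ r ↭ u ∷ v ∷ r) (sym (m≤n⇒m⊓n≡m a≤b)) (sym (m≤n⇒m⊔n≡n a≤b)) refl
... | inj₂ b≤a = subst₂ (λ u v → a ∷ b ∷ r ↭ u ∷ v ∷ r) (sym (m≥n⇒m⊓n≡n b≤a)) (sym (m≥n⇒m⊔n≡m b≤a)) (swap a b refl)

valueF-bound : ∀ {e β} f M → 1 ≤ e → length M ≡ f → Indivisible e β M → valueF e f M ≤ β + e
valueF-bound zero M _ len≡ _ = subst (_≤ _) (sym len≡) z≤n
valueF-bound {e} {β} (suc f) M 1≤e len≡ inv with sum M + 2 ≤? 2 * maxList M + e
... | yes final = Indivisible-final final inv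
... | no _ with picks M in picks≡
...   | []    = ≤-trans (picks≡[]⇒length≤1 M picks≡) (≤-trans 1≤e (m≤n+m e β))
...   | _ ∷ _ = foldr-preservesᵇ {P = _≤ β + e} ⊔-lub z≤n
                  (map⁺ (All.map (λ { {a , b , r} → move a b r }) (subst (All (PickOf M)) picks≡ (picks-↭ M))))
  where
  move : ∀ a b r → M ↭ a ∷ b ∷ r → valueF e f (a ⊔ b + a ⊓ b ∷ r) ⊓ valueF e f (a ⊔ b ∸ a ⊓ b ∷ r) ≤ β + e
  move a b r M↭ =
    [ (λ inv′ → ≤-trans (m⊓n≤m _ _) (valueF-bound f _ 1≤e len≡′ inv′))
    , (λ inv′ → ≤-trans (m⊓n≤n _ _) (valueF-bound f _ 1≤e len≡′ inv′))
    ]′ (Indivisible-merge r (m⊓n≤m⊔n a b) (Indivisible-↭ (↭-trans M↭ (↭-⊓⊔ a b r)) inv))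
    where
    len≡′ : suc (length r) ≡ f
    len≡′ = suc-injective (trans (sym (↭-length M↭)) len≡)

[k+1]*[n+1]C[k+1]≡[n+1]*nCk : ∀ n k → suc k * (suc n C suc k) ≡ suc n * (n C k)
[k+1]*[n+1]C[k+1]≡[n+1]*nCk zero    zero    = refl
[k+1]*[n+1]C[k+1]≡[n+1]*nCk zero    (suc k) = *-zeroʳ (suc (suc k))
[k+1]*[n+1]C[k+1]≡[n+1]*nCk (suc n) zero    = trans (+-identityʳ _) (trans (nC1≡n (suc (suc n))) (sym (*-identityʳ _)))
[k+1]*[n+1]C[k+1]≡[n+1]*nCk (suc n) (suc k) = begin
  suc (suc k) * (suc (suc n) C suc (suc k))  ≡⟨ cong (suc (suc k) *_) (nCk+nC[k+1]≡[n+1]C[k+1] (suc n) (suc k)) ⟨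
  suc (suc k) * (X + Y)                      ≡⟨ expand k X Y ⟩
  suc k * X + X + suc (suc k) * Y            ≡⟨ cong₂ (λ u v → u + X + v) ([k+1]*[n+1]C[k+1]≡[n+1]*nCk n k)
                                                                          ([k+1]*[n+1]C[k+1]≡[n+1]*nCk n (suc k)) ⟩
  suc n * (n C k) + X + suc n * (n C suc k)  ≡⟨ collect n (n C k) (n C suc k) X ⟩
  suc n * (n C k + n C suc k) + X            ≡⟨ cong (λ z → suc n * z + X) (nCk+nC[k+1]≡[n+1]C[k+1] n k) ⟩
  suc n * X + X                              ≡⟨ +-comm (suc n * X) X ⟩
  suc (suc n) * X                            ∎
  where
  open ≡-Reasoning
  X = suc n C suc k
  Y = suc n C suc (suc k)
  expand : ∀ k X Y → suc (suc k) * (X + Y) ≡ suc k * X + X + suc (suc k) * Y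
  expand = ℕ-solve-∀
  collect : ∀ n P Q X → suc n * P + X + suc n * Q ≡ suc n * (P + Q) + X
  collect = ℕ-solve-∀

central-binomial-suc : ∀ m → suc m * ((suc m + suc m) C suc m) ≡ 2 * (suc (m + m) * ((m + m) C m))
central-binomial-suc m = begin
  suc m * ((suc m + suc m) C suc m)      ≡⟨ cong (suc m *_) (nCk+nC[k+1]≡[n+1]C[k+1] (m + suc m) m) ⟨
  suc m * ((m + suc m) C m + Z)          ≡⟨ cong (λ z → suc m * (z + Z)) symmetric ⟩
  suc m * (Z + Z)                        ≡⟨ double (suc m) Z ⟩
  2 * (suc m * Z)                        ≡⟨ cong (λ z → 2 * (suc m * (z C suc m))) (+-suc m m) ⟩
  2 * (suc m * (suc (m + m) C suc m))    ≡⟨ cong (2 *_) ([k+1]*[n+1]C[k+1]≡[n+1]*nCk (m + m) m) ⟩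
  2 * (suc (m + m) * ((m + m) C m))      ∎
  where
  open ≡-Reasoning
  Z = (m + suc m) C suc m
  symmetric : (m + suc m) C m ≡ Z
  symmetric = trans (nCk≡nC[n∸k] (m≤m+n m (suc m))) (cong ((m + suc m) C_) (m+n∸m≡n m (suc m)))
  double : ∀ a z → a * (z + z) ≡ 2 * (a * z)
  double = ℕ-solve-∀

Odd : ℕ → Set
Odd n = 2 ∤ n

odd-1+j*2 : ∀ j → Odd (suc (j * 2))
odd-1+j*2 j 2∣ = 1≢0 (trans (sym ([m+kn]%n≡m%n 1 j 2)) (n∣m⇒m%n≡0 _ 2 2∣))
  where 1≢0 : 1 ≢ 0
        1≢0 ()

odd-* : ∀ {m n} → Odd m → Odd n → Odd (m * n)
odd-* {m} {n} odd-m odd-n 2∣mn = [ odd-m , odd-n ]′ (euclidsLemma m n (from-yes (prime? 2)) 2∣mn)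

infix 4 v₂[_]≡_
record v₂[_]≡_ (x v : ℕ) : Set where
  constructor odd-part
  field
    q   : ℕ
    odd : Odd q
    x≡  : x ≡ 2 ^ v * q

v₂-odd : ∀ {q} → Odd q → v₂[ q ]≡ 0
v₂-odd {q} odd-q = odd-part q odd-q (sym (*-identityˡ q))

v₂-* : ∀ {x y a b} → v₂[ x ]≡ a → v₂[ y ]≡ b → v₂[ x * y ]≡ a + b
v₂-* {a = a} {b} (odd-part q odd-q refl) (odd-part r odd-r refl) =
  odd-part (q * r) (odd-* odd-q odd-r) $
    trans (interchange (2 ^ a) q (2 ^ b) r) (cong (_* (q * r)) (sym (^-distribˡ-+-* 2 a b)))
  where interchange : ∀ p q r s → p * q * (r * s) ≡ p * r * (q * s)
        interchange = ℕ-solve-∀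

v₂⇒∤ : ∀ {x v} → v₂[ x ]≡ v → ¬ 2 ^ suc v ∣ x
v₂⇒∤ {v = v} (odd-part q odd-q refl) 2^[1+v]∣ =
  odd-q (*-cancelˡ-∣ (2 ^ v) {{m^n≢0 2 v}} (subst (_∣ 2 ^ v * q) (*-comm 2 (2 ^ v)) 2^[1+v]∣))

2*m*n≡m*n*2 : ∀ m n → 2 * m * n ≡ m * n * 2
2*m*n≡m*n*2 m n = trans (*-assoc 2 m n) (*-comm 2 (m * n))

odd*y≡2^b*odd⇒v₂ : ∀ {q y w} b → Odd q → Odd w → q * y ≡ 2 ^ b * w → v₂[ y ]≡ b
odd*y≡2^b*odd⇒v₂ {q} {y} {w} zero odd-q odd-w qy≡ =
  odd-part y (λ 2∣y → odd-w (subst (2 ∣_) (trans qy≡ (*-identityˡ w)) (∣n⇒∣m*n q 2∣y))) (sym (*-identityˡ y))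
odd*y≡2^b*odd⇒v₂ {q} {y} {w} (suc b) odd-q odd-w qy≡
  with euclidsLemma q y (from-yes (prime? 2)) (divides (2 ^ b * w) (trans qy≡ (2*m*n≡m*n*2 (2 ^ b) w)))
... | inj₁ 2∣q = contradiction 2∣q odd-q
... | inj₂ (divides y′ refl)
  with odd-part u odd-u refl ← odd*y≡2^b*odd⇒v₂ b odd-q odd-w
         (*-cancelʳ-≡ _ _ 2 (trans (*-assoc q y′ 2) (trans qy≡ (2*m*n≡m*n*2 (2 ^ b) w))))
  = odd-part u odd-u (sym (2*m*n≡m*n*2 (2 ^ b) u))

v₂-cancelˡ : ∀ {x y a b} → v₂[ x ]≡ a → v₂[ x * y ]≡ a + b → v₂[ y ]≡ b
v₂-cancelˡ {y = y} {a} {b} (odd-part q odd-q refl) (odd-part w odd-w xy≡) =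
  odd*y≡2^b*odd⇒v₂ b odd-q odd-w (*-cancelˡ-≡ _ _ (2 ^ a) {{m^n≢0 2 a}} (begin
    2 ^ a * (q * y)      ≡⟨ *-assoc (2 ^ a) q y ⟨
    2 ^ a * q * y        ≡⟨ xy≡ ⟩
    2 ^ (a + b) * w      ≡⟨ cong (_* w) (^-distribˡ-+-* 2 a b) ⟩
    2 ^ a * 2 ^ b * w    ≡⟨ *-assoc (2 ^ a) (2 ^ b) w ⟩
    2 ^ a * (2 ^ b * w)  ∎))
  where open ≡-Reasoning

B′-fuel : ∀ f g m → m ≤ f → m ≤ g → B′ f m ≡ B′ g m
B′-fuel f       g       zero    _         _         = trans (B′-zero f) (sym (B′-zero g))
  where B′-zero : ∀ f → B′ f 0 ≡ 0
        B′-zero zero    = refl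
        B′-zero (suc f) = B′-zero f
B′-fuel (suc f) (suc g) (suc m) (s≤s m≤f) (s≤s m≤g) =
  cong (λ b → suc m % 2 + b) (B′-fuel f g (suc m / 2) (half≤ m≤f) (half≤ m≤g))
  where half≤ : ∀ {k} → m ≤ k → suc m / 2 ≤ k
        half≤ m≤k = ≤-trans (<⇒≤pred (m/n<m (suc m) 2 (s≤s (s≤s z≤n)))) m≤k

B-even : ∀ j → B (j * 2) ≡ B j
B-even zero    = refl
B-even (suc j) = begin
  (suc j * 2) % 2 + B′ (suc (j * 2)) ((suc j * 2) / 2)
    ≡⟨ cong₂ _+_ (m*n%n≡0 (suc j) 2) (cong (B′ (suc (j * 2))) (m*n/n≡m (suc j) 2)) ⟩
  B′ (suc (j * 2)) (suc j)
    ≡⟨ B′-fuel _ _ (suc j) (s≤s (m≤m*n j 2)) ≤-refl ⟩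
  B (suc j) ∎
  where open ≡-Reasoning

B-odd : ∀ j → B (suc (j * 2)) ≡ suc (B j)
B-odd j = begin
  suc (j * 2) % 2 + B′ (j * 2) (suc (j * 2) / 2)
    ≡⟨ cong₂ _+_ ([m+kn]%n≡m%n 1 j 2) (cong (B′ (j * 2)) half) ⟩
  1 + B′ (j * 2) j
    ≡⟨ cong suc (B′-fuel _ _ j (m≤m*n j 2) ≤-refl) ⟩
  suc (B j) ∎
  where
  open ≡-Reasoning
  half : suc (j * 2) / 2 ≡ j
  half = trans (+-distrib-/ 1 (j * 2) (subst (λ z → 1 + z < 2) (sym (m*n%n≡0 j 2)) ≤-refl)) (m*n/n≡m j 2)

parity : ∀ m → ∃[ j ] (m ≡ j * 2 ⊎ m ≡ suc (j * 2))
parity zero = 0 , inj₁ refl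
parity (suc m) with parity m
... | j , inj₁ m≡ = j , inj₂ (cong suc m≡)
... | j , inj₂ m≡ = suc j , inj₁ (cong suc m≡)

B-suc : ∀ m → ∃[ v ] (v₂[ suc m ]≡ v × B m + 1 ≡ B (suc m) + v)
B-suc = <-rec _ carry
  where
  carry : ∀ m → (∀ {j} → j < m → ∃[ v ] (v₂[ suc j ]≡ v × B j + 1 ≡ B (suc j) + v)) →
          ∃[ v ] (v₂[ suc m ]≡ v × B m + 1 ≡ B (suc m) + v)
  carry m rec with parity m
  ... | j , inj₁ refl = 0 , v₂-odd (odd-1+j*2 j) , (begin
    B (j * 2) + 1          ≡⟨ cong (_+ 1) (B-even j) ⟩
    B j + 1                ≡⟨ +-comm (B j) 1 ⟩
    suc (B j)              ≡⟨ B-odd j ⟨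
    B (suc (j * 2))        ≡⟨ +-identityʳ _ ⟨
    B (suc (j * 2)) + 0    ∎)
    where open ≡-Reasoning
  ... | j , inj₂ refl with v , odd-part q odd-q 1+j≡ , carry-j ← rec (s≤s (m≤m*n j 2)) =
    suc v , odd-part q odd-q (trans (cong (_* 2) 1+j≡) (sym (2*m*n≡m*n*2 (2 ^ v) q))) , (begin
    B (suc (j * 2)) + 1    ≡⟨ cong (_+ 1) (B-odd j) ⟩
    suc (B j + 1)          ≡⟨ cong suc carry-j ⟩
    suc (B (suc j) + v)    ≡⟨ +-suc (B (suc j)) v ⟨
    B (suc j) + suc v      ≡⟨ cong (_+ suc v) (B-even (suc j)) ⟨
    B (suc j * 2) + suc v  ∎)
    where open ≡-Reasoning

v₂-central-binomial : ∀ m → v₂[ (m + m) C m ]≡ B m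
v₂-central-binomial zero    = odd-part 1 (odd-1+j*2 0) refl
v₂-central-binomial (suc m) with v , v₂[1+m] , carry ← B-suc m =
  v₂-cancelˡ v₂[1+m] (subst₂ v₂[_]≡_ (sym (central-binomial-suc m)) exponent
    (v₂-* (odd-part 1 (odd-1+j*2 0) refl) (v₂-* (v₂-odd odd-1+2m) (v₂-central-binomial m))))
  where
  odd-1+2m : Odd (suc (m + m))
  odd-1+2m = subst (λ z → Odd (suc z)) (trans (*-comm m 2) (cong (λ z → m + z) (+-identityʳ m))) (odd-1+j*2 m)
  exponent : 1 + (0 + B m) ≡ v + B (suc m)
  exponent = trans (+-comm 1 (B m)) (trans carry (+-comm (B (suc m)) v))

sum-replicate-1 : ∀ n → sum (replicate n 1) ≡ n
sum-replicate-1 zero    = refl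
sum-replicate-1 (suc n) = cong suc (sum-replicate-1 n)

Indivisible-initial : ∀ e m → Indivisible e (B m) (replicate (e + (m + m)) 1)
Indivisible-initial e m = indivisible m sum≡ ∤central
  where
  sum≡ : sum (replicate (e + (m + m)) 1) ≡ 2 * m + e
  sum≡ = trans (sum-replicate-1 (e + (m + m))) (reorder e m)
    where reorder : ∀ e m → e + (m + m) ≡ 2 * m + e
          reorder = ℕ-solve-∀
  ∤central : ¬ 2^ suc (B m) ∣ coeff e (replicate (e + (m + m)) 1) (+ m)
  ∤central = v₂⇒∤ (v₂-central-binomial m) ∘ ℤ.∣⇒∣ᵤ
           ∘ subst (2^ suc (B m) ∣_) (trans (coeff-replicate e (m + m) (+ m)) (coeff₀-replicate (m + m) m))

n≡[2k∸n]+2[n∸k] : ∀ {n k} → k ≤ n → n ≤ 2 * k → n ≡ (2 * k ∸ n) + ((n ∸ k) + (n ∸ k))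
n≡[2k∸n]+2[n∸k] {k = k} k≤n n≤2k with m , refl ← m≤n⇒∃[o]m+o≡n k≤n
  with r , refl ← m≤n⇒∃[o]m+o≡n (+-cancelˡ-≤ k m k (subst (k + m ≤_) (cong (λ z → k + z) (+-identityʳ k)) n≤2k)) =
  trans (total m r) (sym (cong₂ (λ u v → u + (v + v)) 2k∸n≡r n∸k≡m))
  where
  n∸k≡m : m + r + m ∸ (m + r) ≡ m
  n∸k≡m = m+n∸m≡n (m + r) m
  2k∸n≡r : 2 * (m + r) ∸ (m + r + m) ≡ r
  2k∸n≡r = trans (cong (_∸ (m + r + m)) (excess m r)) (m+n∸m≡n (m + r + m) r)
    where excess : ∀ m r → 2 * (m + r) ≡ m + r + m + r
          excess = ℕ-solve-∀
  total : ∀ m r → m + r + m ≡ r + (m + m)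
  total = ℕ-solve-∀

proposition2 : (n k : ℕ) → n < 2 * k → k ≤ n →
    V (2 * k ∸ n) (replicate n 1) ≤ B (n ∸ k) + (2 * k ∸ n)
proposition2 n k n<2k k≤n =
  valueF-bound (length (replicate n 1)) (replicate n 1) (m<n⇒0<n∸m n<2k) refl
    (subst (λ z → Indivisible (2 * k ∸ n) (B (n ∸ k)) (replicate z 1))
      (sym (n≡[2k∸n]+2[n∸k] k≤n (<⇒≤ n<2k)))
      (Indivisible-initial (2 * k ∸ n) (n ∸ k)))
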